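{- In the game \textsc{saliquant}, let $n$ be a positive integer and $k$ an integer. If $\mathcal{SG}(2n)=n-k$, then $2k-1\mid n$.
   Context: \textsc{saliquant} is the normal-play impartial game whose positions are the positive integers, where the options of a position $n\geq 1$ are $\{n-k : 1\leq k\leq n,\ k\nmid n\}$. The nim-value is defined recursively by $\mathcal{SG}(n)=\operatorname{mex}\{\mathcal{SG}(x) : x \text{ an option of } n\}$, where $\operatorname{mex}(A)$ is the least nonnegative integer not in $A$. -}

module Defs where

open import Data.Nat using (ℕ; zero; suc; _∸_)
open import Data.Nat.Divisibility using (_∣?_)
open import Data.List using (List; []; _∷_; length; _++_; [_])
open import Data.List.Membership.DecPropositional (Data.Nat._≟_) using (_∈?_)
open import Relation.Nullary using (does; yes; no)
open import Data.Bool using (if_then_else_)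

-- mex of a finite list: the least natural number not in the list.
-- (The search from 0 with fuel length xs always suffices.)
mexFrom : ℕ → ℕ → List ℕ → ℕ
mexFrom zero    i xs = i
mexFrom (suc f) i xs = if does (i ∈? xs) then mexFrom f (suc i) xs else i

mex : List ℕ → ℕ
mex xs = mexFrom (length xs) 0 xs

-- index into a list (default 0 out of range; never used out of range below)
at : List ℕ → ℕ → ℕ
at []       _       = 0
at (x ∷ xs) zero    = x
at (x ∷ xs) (suc i) = at xs i

-- nim-values of the options of n, given table t with  at t m = SG m  for m < n.
-- Options of n: n ∸ k for 1 ≤ k ≤ n with k ∤ n.
optVals : (n : ℕ) → List ℕ → ℕ → List ℕ
optVals n t zero    = []
optVals n t (suc k) with suc k ∣? n
... | yes _ = optVals n t k
... | no  _ = at t (n ∸ suc k) ∷ optVals n t k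

table : ℕ → List ℕ
table zero    = []
table (suc n) = table n ++ [ mex (optVals n (table n) n) ]

SG : ℕ → ℕ
SG n = mex (optVals n (table n) n)

-- Since 1 divides every position, every move removes at least two tokens, and induction gives
-- 2·SG(m) ≤ m. Consequently, from an odd position 2n+1 every smaller odd position 2i+1 is
-- reachable (an even number of tokens never divides an odd one) and has value i by induction,
-- so SG(2n+1) = n. Now let s = SG(2n) and k = n − s ≥ 0. If k ≥ 1, the odd position 2s+1 is
-- 2n − (2k−1) and has value s, so it cannot be an option of 2n: hence 2k−1 divides 2n, and
-- being odd it divides n. If k = 0 the claim is −1 ∣ n.
module Submission where

open import Defs
open import Data.Nat
open import Data.Nat.Properties
open import Data.Nat.Divisibility using (_∣_; _∣?_; divides; ∣-trans; 1∣_; m∣m*n; n∣m*n; ∣m+n∣m⇒∣n)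
open import Data.Nat.Induction using (<-rec)
open import Data.Nat.Tactic.RingSolver using (solve-∀)
open import Data.List using (List; []; _∷_; length; _++_; [_]; lookup)
open import Data.List.Properties using (length-++)
open import Data.List.Membership.Propositional using (_∈_; _∉_)
open import Data.List.Membership.DecPropositional (Data.Nat._≟_) using (_∈?_)
open import Data.List.Relation.Unary.Any using (here; there; index)
open import Data.List.Relation.Unary.Any.Properties using (lookup-index)
import Data.Fin as Fin
open import Data.Fin using (toℕ)
open import Data.Fin.Properties using (pigeonhole; toℕ≤pred[n])
open import Data.Product using (∃-syntax; ∃₂; _×_; _,_)
open import Data.Sum using (_⊎_; inj₁; inj₂)
open import Relation.Nullary using (¬_; yes; no; contradiction)
open import Relation.Binary.PropositionalEquality
  using (_≡_; refl; sym; trans; cong; subst; module ≡-Reasoning)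
open import Data.Integer as ℤ using (ℤ; +_; ∣_∣)
import Data.Integer.Properties as ℤP
import Data.Integer.Divisibility as ℤD
import Data.Integer.Tactic.RingSolver as ℤSolver

mexFrom-minimal : ∀ f i xs {v} → i ≤ v → v < mexFrom f i xs → v ∈ xs
mexFrom-minimal zero    i xs i≤v v<i = contradiction i≤v (<⇒≱ v<i)
mexFrom-minimal (suc f) i xs {v} i≤v v<r with i ∈? xs
... | no _ = contradiction i≤v (<⇒≱ v<r)
... | yes i∈xs with i ≟ v
...   | yes refl = i∈xs
...   | no i≢v   = mexFrom-minimal f (suc i) xs (≤∧≢⇒< i≤v i≢v) v<r

mexFrom-∉⊎≡ : ∀ f i xs → mexFrom f i xs ∉ xs ⊎ mexFrom f i xs ≡ i + f
mexFrom-∉⊎≡ zero    i xs = inj₂ (sym (+-identityʳ i))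
mexFrom-∉⊎≡ (suc f) i xs with i ∈? xs
... | no i∉xs = inj₁ i∉xs
... | yes _ with mexFrom-∉⊎≡ f (suc i) xs
...   | inj₁ r∉xs = inj₁ r∉xs
...   | inj₂ r≡   = inj₂ (trans r≡ (sym (+-suc i f)))

¬[≤length]⊆ : (xs : List ℕ) → ¬ (∀ v → v ≤ length xs → v ∈ xs)
¬[≤length]⊆ xs ⊆xs = collision (pigeonhole (n<1+n (length xs)) (λ v → index (∈xs v)))
  where
  ∈xs : ∀ v → toℕ v ∈ xs
  ∈xs v = ⊆xs (toℕ v) (toℕ≤pred[n] v)
  collision : ¬ ∃₂ λ i j → i Fin.< j × index (∈xs i) ≡ index (∈xs j)
  collision (i , j , i<j , same) =
    <-irrefl (trans (lookup-index (∈xs i)) (trans (cong (lookup xs) same) (sym (lookup-index (∈xs j))))) i<j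

mex-minimal : ∀ xs {v} → v < mex xs → v ∈ xs
mex-minimal xs = mexFrom-minimal (length xs) 0 xs z≤n

mex-∉ : ∀ xs → mex xs ∉ xs
mex-∉ xs mex∈xs with mexFrom-∉⊎≡ (length xs) 0 xs
... | inj₁ mex∉xs = mex∉xs mex∈xs
... | inj₂ mex≡len = ¬[≤length]⊆ xs ≤len⊆xs
  where
  ≤len⊆xs : ∀ v → v ≤ length xs → v ∈ xs
  ≤len⊆xs v v≤len with m≤n⇒m<n∨m≡n v≤len
  ... | inj₁ v<len = mex-minimal xs (subst (v <_) (sym mex≡len) v<len)
  ... | inj₂ refl  = subst (_∈ xs) mex≡len mex∈xs

≤-mex : ∀ xs j → (∀ {i} → i < j → i ∈ xs) → j ≤ mex xs
≤-mex xs j <j⊆xs with j ≤? mex xs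
... | yes j≤mex = j≤mex
... | no j≰mex  = contradiction (<j⊆xs (≰⇒> j≰mex)) (mex-∉ xs)

length-table : ∀ n → length (table n) ≡ n
length-table zero    = refl
length-table (suc n) = begin
  length (table n ++ _)  ≡⟨ length-++ (table n) ⟩
  length (table n) + 1   ≡⟨ +-comm (length (table n)) 1 ⟩
  suc (length (table n)) ≡⟨ cong suc (length-table n) ⟩
  suc n                  ∎
  where open ≡-Reasoning

at-++-< : ∀ xs y {i} → i < length xs → at (xs ++ [ y ]) i ≡ at xs i
at-++-< (x ∷ xs) y {zero}  _         = refl
at-++-< (x ∷ xs) y {suc i} (s≤s i<) = at-++-< xs y i<

at-++-length : ∀ xs y → at (xs ++ [ y ]) (length xs) ≡ y
at-++-length []       y = refl
at-++-length (x ∷ xs) y = at-++-length xs y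

at-table : ∀ {n m} → m < n → at (table n) m ≡ SG m
at-table {suc n} {m} m<1+n with m≤n⇒m<n∨m≡n (s≤s⁻¹ m<1+n)
... | inj₁ m<n = trans (at-++-< (table n) _ (subst (m <_) (sym (length-table n)) m<n)) (at-table m<n)
... | inj₂ refl = subst (λ i → at (table (suc m)) i ≡ SG m) (length-table m) (at-++-length (table m) _)

options : ℕ → List ℕ
options n = optVals n (table n) n

-- A move n ↦ n − d, with n written as m + d to avoid truncated subtraction.
infix 4 _↝_
data _↝_ : ℕ → ℕ → Set where
  remove : ∀ {m d} → 1 ≤ d → ¬ d ∣ m + d → m + d ↝ m

↝-intro : ∀ {n m d} → m + d ≡ n → 1 ≤ d → ¬ d ∣ n → n ↝ m
↝-intro refl = remove

↝⇒2+m≤n : ∀ {n m} → n ↝ m → 2 + m ≤ n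
↝⇒2+m≤n (remove {d = suc zero} _ 1∤n) = contradiction (1∣ _) 1∤n
↝⇒2+m≤n (remove {m} {suc (suc d)} _ _) = begin
  2 + m           ≡⟨ +-comm 2 m ⟩
  m + 2           ≤⟨ +-monoʳ-≤ m (s≤s (s≤s z≤n)) ⟩
  m + suc (suc d) ∎
  where open ≤-Reasoning

↝⇒< : ∀ {n m} → n ↝ m → m < n
↝⇒< n↝m = ≤-trans (n≤1+n _) (↝⇒2+m≤n n↝m)

optVals-∈ : ∀ n t K {j} → 1 ≤ j → j ≤ K → ¬ j ∣ n → at t (n ∸ j) ∈ optVals n t K
optVals-∈ n t zero (s≤s _) () _
optVals-∈ n t (suc K) 1≤j j≤1+K j∤n with suc K ∣? n | m≤n⇒m<n∨m≡n j≤1+K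
... | yes 1+K∣n | inj₂ refl = contradiction 1+K∣n j∤n
... | yes _     | inj₁ j<1+K = optVals-∈ n t K 1≤j (s≤s⁻¹ j<1+K) j∤n
... | no _      | inj₂ refl = here refl
... | no _      | inj₁ j<1+K = there (optVals-∈ n t K 1≤j (s≤s⁻¹ j<1+K) j∤n)

optVals-∈⁻ : ∀ n t K {v} → v ∈ optVals n t K →
             ∃[ j ] 1 ≤ j × j ≤ K × ¬ j ∣ n × v ≡ at t (n ∸ j)
optVals-∈⁻ n t (suc K) v∈ with suc K ∣? n
optVals-∈⁻ n t (suc K) v∈ | yes _ with optVals-∈⁻ n t K v∈
... | j , 1≤j , j≤K , j∤n , v≡ = j , 1≤j , m≤n⇒m≤1+n j≤K , j∤n , v≡
optVals-∈⁻ n t (suc K) (here v≡) | no 1+K∤n = suc K , s≤s z≤n , ≤-refl , 1+K∤n , v≡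
optVals-∈⁻ n t (suc K) (there v∈) | no _ with optVals-∈⁻ n t K v∈
... | j , 1≤j , j≤K , j∤n , v≡ = j , 1≤j , m≤n⇒m≤1+n j≤K , j∤n , v≡

↝⇒SG∈options : ∀ {n m} → n ↝ m → SG m ∈ options n
↝⇒SG∈options (remove {m} {d} 1≤d d∤n) =
  subst (_∈ options (m + d)) atSG (optVals-∈ (m + d) (table (m + d)) (m + d) 1≤d (m≤n+m d m) d∤n)
  where
  atSG : at (table (m + d)) (m + d ∸ d) ≡ SG m
  atSG = trans (cong (at (table (m + d))) (m+n∸n≡m m d)) (at-table (m<m+n m 1≤d))

options⇒↝ : ∀ {n v} → v ∈ options n → ∃[ m ] n ↝ m × v ≡ SG m
options⇒↝ {n} v∈ with optVals-∈⁻ n (table n) n v∈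
... | j , 1≤j , j≤n , j∤n , v≡ =
  n ∸ j , ↝-intro (m∸n+n≡m j≤n) 1≤j j∤n , trans v≡ (at-table (∸-monoʳ-< 1≤j j≤n))

SG∉options : ∀ n → SG n ∉ options n
SG∉options n = mex-∉ (options n)

halve : ∀ n → ∃[ h ] 2 * h ≤ n × n ≤ suc (2 * h)
halve zero          = 0 , z≤n , z≤n
halve (suc zero)    = 0 , z≤n , ≤-refl
halve (suc (suc n)) with h , 2h≤n , n≤1+2h ← halve n =
  suc h , ≤-trans (≤-reflexive (*-suc 2 h)) (s≤s (s≤s 2h≤n))
        , ≤-trans (s≤s (s≤s n≤1+2h)) (≤-reflexive (cong suc (sym (*-suc 2 h))))

2*SG[n]≤n : ∀ n → 2 * SG n ≤ n
2*SG[n]≤n = <-rec _ step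
  where
  step : ∀ n → (∀ {m} → m < n → 2 * SG m ≤ m) → 2 * SG n ≤ n
  step n IH with 2 * SG n ≤? n
  ... | yes 2s≤n = 2s≤n
  ... | no 2s≰n with h , 2h≤n , n≤1+2h ← halve n
                  with options⇒↝ (mex-minimal (options n)
                         (*-cancelˡ-< 2 h (SG n) (≤-<-trans 2h≤n (≰⇒> 2s≰n))))
  ...   | m , n↝m , refl =
    contradiction n≤1+2h (<⇒≱ (≤-trans (+-monoʳ-≤ 2 (IH (↝⇒< n↝m))) (↝⇒2+m≤n n↝m)))

2∤1+2*n : ∀ n → ¬ 2 ∣ suc (2 * n)
2∤1+2*n n (divides q 1+2n≡q*2) = even≢odd q n (trans (*-comm 2 q) (sym 1+2n≡q*2))

odd↝odd : ∀ {i n} → i < n → suc (2 * n) ↝ suc (2 * i)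
odd↝odd {i} i<n with e , refl ← m≤n⇒∃[o]m+o≡n i<n =
  ↝-intro (split i e) (s≤s z≤n) (λ d∣ → 2∤1+2*n (suc i + e) (∣-trans (m∣m*n (suc e)) d∣))
  where
  split : ∀ i e → suc (2 * i) + 2 * suc e ≡ suc (2 * (suc i + e))
  split = solve-∀

SG[1+2n]≡n : ∀ n → SG (suc (2 * n)) ≡ n
SG[1+2n]≡n = <-rec _ λ n IH → ≤-antisym (upper n) (≤-mex _ n (λ i<n → value∈ i<n (IH i<n)))
  where
  upper : ∀ n → SG (suc (2 * n)) ≤ n
  upper n = s≤s⁻¹ (*-cancelˡ-< 2 _ (suc n)
    (≤-trans (s≤s (2*SG[n]≤n (suc (2 * n)))) (≤-reflexive (sym (*-suc 2 n)))))
  value∈ : ∀ {i n} → i < n → SG (suc (2 * i)) ≡ i → i ∈ options (suc (2 * n))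
  value∈ {n = n} i<n SG≡i = subst (_∈ options (suc (2 * n))) SG≡i (↝⇒SG∈options (odd↝odd i<n))

odd∣2*n⇒∣n : ∀ e n → suc (2 * e) ∣ 2 * n → suc (2 * e) ∣ n
odd∣2*n⇒∣n e n d∣2n =
  ∣m+n∣m⇒∣n (subst (suc (2 * e) ∣_) (split e n) (∣-trans d∣2n (n∣m*n (suc e)))) (m∣m*n n)
  where
  split : ∀ e n → suc e * (2 * n) ≡ suc (2 * e) * n + n
  split = solve-∀

SG[2n]+1+e≡n⇒1+2e∣n : ∀ n e → SG (2 * n) + suc e ≡ n → suc (2 * e) ∣ n
SG[2n]+1+e≡n⇒1+2e∣n n e s+1+e≡n with suc (2 * e) ∣? 2 * n
... | yes d∣2n = odd∣2*n⇒∣n e n d∣2n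
... | no d∤2n  =
  contradiction (subst (_∈ options (2 * n)) (SG[1+2n]≡n s) (↝⇒SG∈options move)) (SG∉options (2 * n))
  where
  s = SG (2 * n)
  split : ∀ s e → suc (2 * s) + suc (2 * e) ≡ 2 * (s + suc e)
  split = solve-∀
  move : 2 * n ↝ suc (2 * s)
  move = ↝-intro (trans (split s e) (cong (2 *_) s+1+e≡n)) (s≤s z≤n) d∤2n

∣2[1+e]-1∣≡1+2e : ∀ e → ∣ + 2 ℤ.* + suc e ℤ.- + 1 ∣ ≡ suc (2 * e)
∣2[1+e]-1∣≡1+2e e = +-suc e (e + 0)

a≡b-k⇒k≡b-a : ∀ {a b k : ℤ} → a ≡ b ℤ.- k → k ≡ b ℤ.- a
a≡b-k⇒k≡b-a {a} {b} {k} a≡b-k = trans (sym (cancel b k)) (cong (λ a → b ℤ.- a) (sym a≡b-k))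
  where
  cancel : ∀ b k → b ℤ.- (b ℤ.- k) ≡ k
  cancel = ℤSolver.solve-∀

mainTheorem8 : (n : ℕ) (k : ℤ) → 1 ≤ n →
    + SG (2 Data.Nat.* n) ≡ + n ℤ.- k → (+ 2 ℤ.* k ℤ.- + 1) ℤD.∣ + n
mainTheorem8 n k _ SG≡n-k =
  subst (λ k → (+ 2 ℤ.* k ℤ.- + 1) ℤD.∣ + n) (sym k≡n∸s)
    (deficit-divides (n ∸ s) (m+[n∸m]≡n s≤n))
  where
  s = SG (2 * n)
  s≤n : s ≤ n
  s≤n = *-cancelˡ-≤ 2 (2*SG[n]≤n (2 * n))
  k≡n∸s : k ≡ + (n ∸ s)
  k≡n∸s = trans (a≡b-k⇒k≡b-a {b = + n} SG≡n-k) (trans (ℤP.m-n≡m⊖n n s) (ℤP.⊖-≥ s≤n))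
  deficit-divides : ∀ t → s + t ≡ n → (+ 2 ℤ.* + t ℤ.- + 1) ℤD.∣ + n
  deficit-divides zero    _       = 1∣ n
  deficit-divides (suc e) s+t≡n =
    subst (_∣ n) (sym (∣2[1+e]-1∣≡1+2e e)) (SG[2n]+1+e≡n⇒1+2e∣n n e s+t≡n)
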